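{- Let $H=(V,E)$ be a hypergraph with $V\notin E$, let $k$ be a positive integer, and let $t$ be a $k$-edge-tuple in $H$. Consider the call $\textsc{SolveSetCover}(H,k,t)$. If it returns $S\neq\perp$, then $S$ is a solution for $(H,k,t)$; if it returns $\perp$, then there is no solution for $(H,k,t)$.
   Context: A hypergraph is a pair $H=(V,E)$ with $V$ finite and $E\subseteq2^V$; a cover of $H$ is a set $F\subseteq E$ such that every vertex lies in some edge of $F$. The intersection-closure of $H$ is the smallest hypergraph $H'=(V,E')$ with $E\subseteq E'$, $V\in E'$ and $E'$ closed under pairwise intersection. For $S\subseteq V$, $K_H(S)=\{e\in E:S\subseteq e\}$ and $M_H(S)=V$ if $K_H(S)=\emptyset$, $M_H(S)=\bigcap_{e\in K_H(S)}e$ otherwise. A $k$-edge-tuple in $H$ is a tuple $t=(e_1,\ldots,e_k)$ with each $e_i\in E'\setminus\{V\}$; $t[i\to e]$ denotes $t$ with its $i$-th entry replaced by $e$. A solution for $(H,k,t)$ with $t=(e_1,\ldots,e_k)$ is a set $\{f_1,\ldots,f_k\}\subseteq E$ with $e_i\subseteq f_i$ for all $i\in[k]$ which is a cover of $H$. The recursive procedure $\textsc{SolveSetCover}(H,k,t)$, with $t=(e_1,\ldots,e_k)$, is: let $C=e_1\cup\cdots\cup e_k$. If $C=V$, choose for each $i$ an edge $f_i\in E$ with $e_i\subseteq f_i$ and return $\{f_1,\ldots,f_k\}$. Otherwise choose $v\in V\setminus C$; for $i=1,\ldots,k$ in turn: let $f=M_H(e_i\cup\{v\})$; if $f\neq V$,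 compute $r=\textsc{SolveSetCover}(H,k,t[i\to f])$ and if $r\neq\perp$ return $r$. If the loop finishes, return $\perp$. -}

module Defs where

open import Data.Nat using (ℕ)
open import Data.Fin using (Fin)
open import Data.Fin.Subset using (Subset; _⊆_; _∩_; _∪_; ⊤; ⊥; ⁅_⁆; ⋃) renaming (_∈_ to _∈ₛ_; _∉_ to _∉ₛ_)
open import Data.Fin.Subset.Properties using (_⊆?_)
open import Data.List using (List; []; _∷_; filter; foldr; allFin)
open import Data.List.Membership.Propositional using () renaming (_∈_ to _∈ₗ_)
open import Data.Vec using (Vec; lookup; toList; _[_]≔_)
open import Data.Maybe using (Maybe; just; nothing)
open import Data.Product using (_×_; ∃)
open import Relation.Binary.PropositionalEquality using (_≡_; _≢_)

Hypergraph : ℕ → Set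
Hypergraph n = List (Subset n)

data InClosure {n : ℕ} (E : Hypergraph n) : Subset n → Set where
  base  : ∀ {e} → e ∈ₗ E → InClosure E e
  whole : InClosure E ⊤
  inter : ∀ {a b} → InClosure E a → InClosure E b → InClosure E (a ∩ b)

K : ∀ {n} → Hypergraph n → Subset n → List (Subset n)
K E S = filter (S ⊆?_) E

M : ∀ {n} → Hypergraph n → Subset n → Subset n
M E S with K E S
... | []     = ⊤
... | e ∷ es = foldr _∩_ e es

EdgeTuple : ∀ {n k} → Hypergraph n → Vec (Subset n) k → Set
EdgeTuple E t = ∀ i → InClosure E (lookup t i) × lookup t i ≢ ⊤

Union : ∀ {n k} → Vec (Subset n) k → Subset n
Union t = ⋃ (toList t)

Covers : ∀ {n k} → Vec (Subset n) k → Set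
Covers {n} fs = ∀ (v : Fin n) → ∃ λ i → v ∈ₛ lookup fs i

Solution : ∀ {n k} → Hypergraph n → Vec (Subset n) k → Vec (Subset n) k → Set
Solution E t fs = (∀ i → lookup fs i ∈ₗ E × lookup t i ⊆ lookup fs i) × Covers fs

-- Big-step semantics of SolveSetCover(H,k,t), covering every possible
-- resolution of the nondeterministic choices ("choose f_i", "choose v").
-- Returns E t r : some execution of the call on t returns r
-- (nothing = ⊥, just fs = {f_1,...,f_k}).
mutual
  data Returns {n k : ℕ} (E : Hypergraph n) (t : Vec (Subset n) k)
       : Maybe (Vec (Subset n) k) → Set where
    done : Union t ≡ ⊤ → (fs : Vec (Subset n) k)
         → (∀ i → lookup fs i ∈ₗ E × lookup t i ⊆ lookup fs i)
         → Returns E t (just fs)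
    step : ∀ {r} → Union t ≢ ⊤ → (v : Fin n) → v ∉ₛ Union t
         → Loop E t v (allFin k) r → Returns E t r

  data Loop {n k : ℕ} (E : Hypergraph n) (t : Vec (Subset n) k) (v : Fin n)
       : List (Fin k) → Maybe (Vec (Subset n) k) → Set where
    loopEnd   : Loop E t v [] nothing
    loopSkip  : ∀ {i is r} → M E (lookup t i ∪ ⁅ v ⁆) ≡ ⊤
              → Loop E t v is r → Loop E t v (i ∷ is) r
    loopFound : ∀ {i is fs} → M E (lookup t i ∪ ⁅ v ⁆) ≢ ⊤
              → Returns E (t [ i ]≔ M E (lookup t i ∪ ⁅ v ⁆)) (just fs)
              → Loop E t v (i ∷ is) (just fs)
    loopFail  : ∀ {i is r} → M E (lookup t i ∪ ⁅ v ⁆) ≢ ⊤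
              → Returns E (t [ i ]≔ M E (lookup t i ∪ ⁅ v ⁆)) nothing
              → Loop E t v is r → Loop E t v (i ∷ is) r

-- Soundness: a returned tuple is built by `done` from edges f_i ⊇ e_i whose
-- guard says the e_i already cover V; each recursive call only enlarges one
-- entry (e_i ⊆ M(e_i ∪ {v})), so that solution also fits the original tuple.
-- Completeness: take a solution {f_1,…,f_k} and the uncovered vertex v, say
-- v ∈ f_j.  Since M(e_j ∪ {v}) is the intersection of all edges containing
-- e_j ∪ {v}, it lies below the edge f_j ≠ V; hence branch j is taken (not
-- skipped), and the same solution still fits the refined tuple, so that
-- branch cannot return ⊥.
module Submission where

open import Defs
open import Data.Nat using (ℕ; _≤_)
open import Data.Fin using (Fin; zero; suc; _≟_)
open import Data.Fin.Subset using (Subset; ⊤; _⊆_; _∩_; _∪_; ⁅_⁆)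
  renaming (_∈_ to _∈ₛ_)
open import Data.Fin.Subset.Properties
  using (_⊆?_; ∈⊤; ⊆⊤; ∉⊥; ⊆-trans; ⊆-antisym; p∩q⊆p; p∩q⊆q; x∈p∩q⁺; p⊆p∪q; x∈p∪q⁻; x∈⁅y⁆⇒x≡y)
open import Data.List using ([]; _∷_; foldr)
open import Data.List.Membership.Propositional using (_∉_) renaming (_∈_ to _∈ₗ_)
open import Data.List.Membership.Propositional.Properties using (∈-filter⁺; ∈-filter⁻; ∈-allFin)
open import Data.List.Relation.Unary.Any using (here; there)
open import Data.Vec using (Vec; []; _∷_; lookup; _[_]≔_)
open import Data.Vec.Properties using (lookup∘update; lookup∘update′)
open import Data.Maybe using (Maybe; just; nothing)
open import Data.Product using (_×_; ∃; _,_; proj₁; proj₂)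
open import Data.Sum using (inj₁; inj₂)
open import Data.Empty using (⊥)
open import Relation.Nullary using (¬_; yes; no)
open import Relation.Binary.PropositionalEquality using (_≡_; _≢_; refl; sym; subst)

private
  variable
    n k : ℕ

foldr-∩-⊆ : ∀ {x : Subset n} e es → x ∈ₗ e ∷ es → foldr _∩_ e es ⊆ x
foldr-∩-⊆ e []       (here refl)         = λ p → p
foldr-∩-⊆ e (y ∷ es) (here refl)         = ⊆-trans (p∩q⊆q y _) (foldr-∩-⊆ e es (here refl))
foldr-∩-⊆ e (y ∷ es) (there (here refl)) = p∩q⊆p y _
foldr-∩-⊆ e (y ∷ es) (there (there x∈)) = ⊆-trans (p∩q⊆q y _) (foldr-∩-⊆ e es (there x∈))

⊆-foldr-∩ : ∀ {S : Subset n} e es → (∀ {x} → x ∈ₗ e ∷ es → S ⊆ x) → S ⊆ foldr _∩_ e es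
⊆-foldr-∩ e []       lower = lower (here refl)
⊆-foldr-∩ {S = S} e (y ∷ es) lower p =
  x∈p∩q⁺ (lower (there (here refl)) p , ⊆-foldr-∩ e es lower′ p)
  where
  lower′ : ∀ {x} → x ∈ₗ e ∷ es → S ⊆ x
  lower′ (here eq)  = lower (here eq)
  lower′ (there x∈) = lower (there (there x∈))

∪⁅⁆-⊆ : ∀ {a b : Subset n} {v} → a ⊆ b → v ∈ₛ b → a ∪ ⁅ v ⁆ ⊆ b
∪⁅⁆-⊆ {a = a} {v = v} a⊆b v∈b p with x∈p∪q⁻ a ⁅ v ⁆ p
... | inj₁ p∈a = a⊆b p∈a
... | inj₂ p∈v with x∈⁅y⁆⇒x≡y v p∈v
... | refl = v∈b

∈-Union⁻ : ∀ (t : Vec (Subset n) k) {v} → v ∈ₛ Union t → ∃ λ i → v ∈ₛ lookup t i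
∈-Union⁻ []      v∈ with () ← ∉⊥ v∈
∈-Union⁻ (e ∷ t) v∈ with x∈p∪q⁻ e _ v∈
... | inj₁ v∈e = zero , v∈e
... | inj₂ v∈t with i , v∈tᵢ ← ∈-Union⁻ t v∈t = suc i , v∈tᵢ

_⊆ᵛ_ : Vec (Subset n) k → Vec (Subset n) k → Set
t ⊆ᵛ u = ∀ i → lookup t i ⊆ lookup u i

⊆ᵛ-[]≔ : ∀ (t : Vec (Subset n) k) i {f} → lookup t i ⊆ f → t ⊆ᵛ (t [ i ]≔ f)
⊆ᵛ-[]≔ t i {f} tᵢ⊆f j p with j ≟ i
... | yes refl = subst (_ ∈ₛ_) (sym (lookup∘update i t f)) (tᵢ⊆f p)
... | no j≢i   = subst (_ ∈ₛ_) (sym (lookup∘update′ j≢i t f)) p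

[]≔-⊆ᵛ : ∀ (t u : Vec (Subset n) k) i {f} → f ⊆ lookup u i → t ⊆ᵛ u → (t [ i ]≔ f) ⊆ᵛ u
[]≔-⊆ᵛ t u i {f} f⊆uᵢ t⊆u j p with j ≟ i
... | yes refl = f⊆uᵢ (subst (_ ∈ₛ_) (lookup∘update i t f) p)
... | no j≢i   = t⊆u j (subst (_ ∈ₛ_) (lookup∘update′ j≢i t f) p)

Union≡⊤⇒Covers : ∀ (t fs : Vec (Subset n) k) → Union t ≡ ⊤ → t ⊆ᵛ fs → Covers fs
Union≡⊤⇒Covers t fs U≡⊤ t⊆fs v with i , v∈tᵢ ← ∈-Union⁻ t (subst (v ∈ₛ_) (sym U≡⊤) ∈⊤) =
  i , t⊆fs i v∈tᵢ

module _ (E : Hypergraph n) where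

  ∈-K⇒⊇ : ∀ S {x} → x ∈ₗ K E S → S ⊆ x
  ∈-K⇒⊇ S x∈K = proj₂ (∈-filter⁻ (S ⊆?_) {xs = E} x∈K)

  ⊆-M : ∀ S → S ⊆ M E S
  ⊆-M S with K E S | ∈-K⇒⊇ S
  ... | []     | _      = ⊆⊤
  ... | e ∷ es | lowerK = ⊆-foldr-∩ e es lowerK

  M-⊆ : ∀ {S e} → e ∈ₗ E → S ⊆ e → M E S ⊆ e
  M-⊆ {S} e∈E S⊆e with K E S | ∈-filter⁺ (S ⊆?_) {xs = E} e∈E S⊆e
  ... | e′ ∷ es | e∈K = foldr-∩-⊆ e′ es e∈K

  M≢⊤ : ⊤ ∉ E → ∀ {S e} → e ∈ₗ E → S ⊆ e → M E S ≢ ⊤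
  M≢⊤ ⊤∉E {e = e} e∈E S⊆e M≡⊤ = ⊤∉E (subst (_∈ₗ E) e≡⊤ e∈E)
    where
    e≡⊤ : e ≡ ⊤
    e≡⊤ = ⊆-antisym ⊆⊤ (subst (_⊆ _) M≡⊤ (M-⊆ e∈E S⊆e))

  branch : Vec (Subset n) k → Fin n → Fin k → Vec (Subset n) k
  branch t v i = t [ i ]≔ M E (lookup t i ∪ ⁅ v ⁆)

  ⊆ᵛ-branch : ∀ (t : Vec (Subset n) k) v i → t ⊆ᵛ branch t v i
  ⊆ᵛ-branch t v i = ⊆ᵛ-[]≔ t i (⊆-trans (p⊆p∪q _) (⊆-M _))

  Solution-antitone : ∀ (t u S : Vec (Subset n) k) → t ⊆ᵛ u → Solution E u S → Solution E t S
  Solution-antitone t u S t⊆u (fits , covers) =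
    (λ i → proj₁ (fits i) , ⊆-trans (t⊆u i) (proj₂ (fits i))) , covers

  Solution-branch : ∀ (t S : Vec (Subset n) k) v i → v ∈ₛ lookup S i
                  → Solution E t S → Solution E (branch t v i) S
  Solution-branch t S v i v∈Sᵢ (fits , covers) =
    (λ j → proj₁ (fits j) , []≔-⊆ᵛ t S i M⊆Sᵢ (λ j → proj₂ (fits j)) j) , covers
    where
    M⊆Sᵢ : M E (lookup t i ∪ ⁅ v ⁆) ⊆ lookup S i
    M⊆Sᵢ = M-⊆ (proj₁ (fits i)) (∪⁅⁆-⊆ (proj₂ (fits i)) v∈Sᵢ)

  mutual
    Returns-sound : ∀ {t S : Vec (Subset n) k} → Returns E t (just S) → Solution E t S
    Returns-sound {t = t} (done U≡⊤ fs fits) = fits , Union≡⊤⇒Covers t fs U≡⊤ (λ i → proj₂ (fits i))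
    Returns-sound (step _ _ _ loop) = Loop-sound loop

    Loop-sound : ∀ {t S : Vec (Subset n) k} {v is} → Loop E t v is (just S) → Solution E t S
    Loop-sound (loopSkip _ loop)   = Loop-sound loop
    Loop-sound (loopFail _ _ loop) = Loop-sound loop
    Loop-sound {t = t} {S} {v} (loopFound {i = i} _ ret) =
      Solution-antitone t (branch t v i) S (⊆ᵛ-branch t v i) (Returns-sound ret)

  module _ (⊤∉E : ⊤ ∉ E) where
    mutual
      Returns-complete : ∀ {t : Vec (Subset n) k} → Returns E t nothing → ¬ ∃ (Solution E t)
      Returns-complete (step _ v _ loop) (S , sol) with j , v∈Sⱼ ← proj₂ sol v =
        Loop-complete S loop sol v∈Sⱼ (∈-allFin j)

      Loop-complete : ∀ {t : Vec (Subset n) k} {v is j} S → Loop E t v is nothing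
                    → Solution E t S → v ∈ₛ lookup S j → j ∈ₗ is → ⊥
      Loop-complete S (loopSkip M≡⊤ _) (fits , _) v∈Sⱼ (here refl) =
        M≢⊤ ⊤∉E (proj₁ (fits _)) (∪⁅⁆-⊆ (proj₂ (fits _)) v∈Sⱼ) M≡⊤
      Loop-complete {t = t} {v} S (loopFail {i = j} _ ret _) sol v∈Sⱼ (here refl) =
        Returns-complete ret (S , Solution-branch t S v j v∈Sⱼ sol)
      Loop-complete S (loopSkip _ loop)   sol v∈Sⱼ (there j∈) = Loop-complete S loop sol v∈Sⱼ j∈
      Loop-complete S (loopFail _ _ loop) sol v∈Sⱼ (there j∈) = Loop-complete S loop sol v∈Sⱼ j∈

lemma4 : ∀ {n k : ℕ} (E : Hypergraph n) → ⊤ ∉ E → 1 ≤ k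
    → (t : Vec (Subset n) k) → EdgeTuple E t
    → (r : Maybe (Vec (Subset n) k)) → Returns E t r
    → (∀ S → r ≡ just S → Solution E t S)
    × (r ≡ nothing → ¬ (∃ λ S → Solution E t S))
lemma4 E ⊤∉E _ t _ r ret =
  (λ { S refl → Returns-sound E ret }) ,
  (λ { refl → Returns-complete E ⊤∉E ret })
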